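{- Let $\Sigma_1=(X_1,X_{1,0},S_1,U,\to_1,Y,h_1)$ and $\Sigma_2=(X_2,X_{2,0},S_2,U,\to_2,Y,h_2)$ be NTSs with common input set $U$ and output set $Y$. Suppose there exists an InitSOP simulation relation $\sim\subseteq X_1\times X_2$ from $\Sigma_1$ to $\Sigma_2$. If $\Sigma_1$ is initial-state opaque, then $\Sigma_2$ is initial-state opaque.
   Context: A nondeterministic transition system (NTS) is a tuple $\Sigma=(X,X_0,S,U,\to,Y,h)$, where $X$ is a (possibly infinite) set of states, $X_0\subseteq X$ the initial states, $S\subseteq X$ the secret states, $U$ a (possibly infinite) set of inputs, $\to\subseteq X\times U\times X$ the transition relation (write $x\xrightarrow{u}x'$ for $(x,u,x')\in\to$), $Y$ a set of outputs and $h:X\to Y$ the output map. $U^*$ is the set of finite sequences $\alpha=\alpha(0)\cdots\alpha(|\alpha|-1)$ over $U$, including the empty one. For $\alpha\in U^*$, a run over $\alpha$ is a nonempty sequence of states $x_0x_1\dots x_k$ with $k\le|\alpha|$, $x_0\in X_0$ and $(x_j,\alpha(j),x_{j+1})\in\to$ for all $j\in\{0,\dots,k-1\}$; it is maximal if $k=|\alpha|$ or there is no $x'$ with $(x_k,\alpha(k),x')\in\to$. $\Sigma$ is initial-state opaque if for every $\alpha\in U^*$ and every maximal run $x_0\dots x_k$ over $\alpha$ with $x_0\in X_0\cap S$, there is a maximal run $x_0'\dots x_k'$ over $\alpha$ with $x_0'\notin S$ and $h(x_j)=h(x_j')$ for all $j\in\{0,\dots,k\}$. A relation $\sim\subseteq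 X_1\times X_2$ is an InitSOP (initial-state opacity-preserving) simulation relation from $\Sigma_1$ to $\Sigma_2$ if: (1a) for every $x_{1,0}\in X_{1,0}\setminus S_1$ there is $x_{2,0}\in X_{2,0}\setminus S_2$ with $(x_{1,0},x_{2,0})\in\sim$; (1b) for every $x_{2,0}\in X_{2,0}\cap S_2$ there is $x_{1,0}\in X_{1,0}\cap S_1$ with $(x_{1,0},x_{2,0})\in\sim$; (2) $h_1(x_1)=h_2(x_2)$ for all $(x_1,x_2)\in\sim$; (3a) for every $(x_1,x_2)\in\sim$ and every transition $x_1\xrightarrow{u}_1x_1'$ there is a transition $x_2\xrightarrow{u}_2x_2'$ (same input $u$) with $(x_1',x_2')\in\sim$; (3b) for every $(x_1,x_2)\in\sim$ and every transition $x_2\xrightarrow{u}_2x_2'$ there is a transition $x_1\xrightarrow{u}_1x_1'$ with $(x_1',x_2')\in\sim$. -}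

module Defs where

open import Level using (Level; _⊔_; suc)
open import Data.Nat using (ℕ; _≤_; _<_)
open import Data.Fin using (Fin; toℕ; inject₁; fromℕ)
open import Data.Fin.Properties using (toℕ<n)
open import Data.List using (List; length; lookup)
open import Data.Product using (Σ; _×_; _,_; ∃)
open import Data.Sum using (_⊎_)
open import Relation.Nullary using (¬_)
open import Relation.Binary.PropositionalEquality using (_≡_)
open import Data.Nat.Properties using (<-≤-trans)

record NTS {a u y : Level} (U : Set u) (Y : Set y) (ℓ : Level)
       : Set (Level.suc (a ⊔ ℓ) ⊔ u ⊔ y) where
  field
    X    : Set a
    X₀   : X → Set ℓ
    S    : X → Set ℓ
    Step : X → U → X → Set ℓ
    h    : X → Y
open NTS public

module _ {a u y ℓ : Level} {U : Set u} {Y : Set y} (Σ' : NTS {a} U Y ℓ) where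

  inputAt : (α : List U) (k : ℕ) → k ≤ length α → Fin k → U
  inputAt α k k≤ j = lookup α (Data.Fin.fromℕ< (<-≤-trans (toℕ<n j) k≤))

  record Run (α : List U) : Set (a ⊔ ℓ) where
    field
      k      : ℕ
      k≤     : k ≤ length α
      st     : Fin (ℕ.suc k) → X Σ'
      init   : X₀ Σ' (st Data.Fin.zero)
      steps  : (j : Fin k) →
               Step Σ' (st (inject₁ j)) (inputAt α k k≤ j) (st (Data.Fin.suc j))
  open Run public

  Maximal : {α : List U} → Run α → Set (a ⊔ ℓ)
  Maximal {α} r =
    (k r ≡ length α) ⊎
    (Σ (k r < length α) λ k< →
       ¬ (Σ (X Σ') λ x' → Step Σ' (st r (fromℕ (k r)))
                                   (lookup α (Data.Fin.fromℕ< k<)) x'))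

  InitialStateOpaque : Set (a ⊔ ℓ ⊔ u ⊔ y)
  InitialStateOpaque =
    (α : List U) (r : Run α) → Maximal r → S Σ' (st r Data.Fin.zero) →
    Σ (Run α) λ r' → Maximal r' × ¬ S Σ' (st r' Data.Fin.zero) ×
      Σ (k r' ≡ k r) λ eq →
        (j : Fin (ℕ.suc (k r))) →
          h Σ' (st r j) ≡ h Σ' (st r' (Data.Fin.cast (Relation.Binary.PropositionalEquality.cong ℕ.suc (Relation.Binary.PropositionalEquality.sym eq)) j))

record IsInitSOPSim {a₁ a₂ u y ℓ₁ ℓ₂ r : Level} {U : Set u} {Y : Set y}
       (Σ₁ : NTS {a₁} U Y ℓ₁) (Σ₂ : NTS {a₂} U Y ℓ₂)
       (_∼_ : X Σ₁ → X Σ₂ → Set r) : Set (a₁ ⊔ a₂ ⊔ u ⊔ y ⊔ ℓ₁ ⊔ ℓ₂ ⊔ r) where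
  field
    init-nonsecret : (x₁ : X Σ₁) → X₀ Σ₁ x₁ → ¬ S Σ₁ x₁ →
      Σ (X Σ₂) λ x₂ → X₀ Σ₂ x₂ × ¬ S Σ₂ x₂ × x₁ ∼ x₂
    init-secret : (x₂ : X Σ₂) → X₀ Σ₂ x₂ → S Σ₂ x₂ →
      Σ (X Σ₁) λ x₁ → X₀ Σ₁ x₁ × S Σ₁ x₁ × x₁ ∼ x₂
    output : (x₁ : X Σ₁) (x₂ : X Σ₂) → x₁ ∼ x₂ → h Σ₁ x₁ ≡ h Σ₂ x₂
    forth : (x₁ : X Σ₁) (x₂ : X Σ₂) → x₁ ∼ x₂ →
      (u : U) (x₁' : X Σ₁) → Step Σ₁ x₁ u x₁' →
      Σ (X Σ₂) λ x₂' → Step Σ₂ x₂ u x₂' × x₁' ∼ x₂'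
    back : (x₁ : X Σ₁) (x₂ : X Σ₂) → x₁ ∼ x₂ →
      (u : U) (x₂' : X Σ₂) → Step Σ₂ x₂ u x₂' →
      Σ (X Σ₁) λ x₁' → Step Σ₁ x₁ u x₁' × x₁' ∼ x₂'

module Submission where

-- A relation R between the states of two systems along which
-- every step of the first system can be matched by an equally labelled step
-- of the second ("R simulates") lets us copy any run of the first system,
-- state by state, into a run of the second system of the same length whose
-- states are R-related to the original ones.  An InitSOP simulation ∼
-- simulates Σ₁ by Σ₂ (condition 3a) and, read backwards, Σ₂ by Σ₁ (3b);
-- the opposite direction also shows that a copied run stays maximal, since
-- a successor of the copy's last state would give one of the original's.
--
-- Theorem 3.7 is then a round trip: a maximal run of Σ₂ from a secret state
-- is copied back to a maximal run of Σ₁ from a secret state (1b), opacity of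
-- Σ₁ yields an output-equivalent maximal run from a non-secret state, and
-- that run is copied forward to Σ₂ from a non-secret state (1a).  Outputs
-- agree at every step because related states have equal outputs (2).

open import Level using (Level)
open import Data.Nat using (ℕ; suc)
open import Data.Fin using (Fin; zero; suc; inject₁; fromℕ)
open import Data.List using (List)
open import Data.Product using (Σ; _×_; _,_; proj₁; proj₂)
open import Data.Sum using (inj₁; inj₂)
open import Function using (_∘_; flip)
open import Relation.Nullary using (¬_)
open import Relation.Binary.PropositionalEquality using (trans; sym)
open import Defs

IsPath : ∀ {a u p} {A : Set a} {U : Set u} (P : A → U → A → Set p)
  {k : ℕ} (lab : Fin k → U) (xs : Fin (suc k) → A) → Set p
IsPath P lab xs = ∀ j → P (xs (inject₁ j)) (lab j) (xs (suc j))

module PathLifting {a b u p q r} {A : Set a} {B : Set b} {U : Set u}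
    (P : A → U → A → Set p) (Q : B → U → B → Set q) (R : A → B → Set r)
    (match : ∀ {x y} → R x y → ∀ {w x'} → P x w x' →
               Σ B λ y' → Q y w y' × R x' y') where

  lift : {k : ℕ} (lab : Fin k → U) (xs : Fin (suc k) → A) → IsPath P lab xs →
         (y₀ : B) → R (xs zero) y₀ → Fin (suc k) → B
  lift lab xs path y₀ r₀ zero = y₀
  lift {suc k} lab xs path y₀ r₀ (suc j) =
    let (y₁ , _ , r₁) = match r₀ (path zero)
    in lift (lab ∘ suc) (xs ∘ suc) (path ∘ suc) y₁ r₁ j

  lift-related : {k : ℕ} (lab : Fin k → U) (xs : Fin (suc k) → A)
    (path : IsPath P lab xs) (y₀ : B) (r₀ : R (xs zero) y₀) →
    ∀ j → R (xs j) (lift lab xs path y₀ r₀ j)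
  lift-related lab xs path y₀ r₀ zero = r₀
  lift-related {suc k} lab xs path y₀ r₀ (suc j) =
    let (y₁ , _ , r₁) = match r₀ (path zero)
    in lift-related (lab ∘ suc) (xs ∘ suc) (path ∘ suc) y₁ r₁ j

  lift-isPath : {k : ℕ} (lab : Fin k → U) (xs : Fin (suc k) → A)
    (path : IsPath P lab xs) (y₀ : B) (r₀ : R (xs zero) y₀) →
    IsPath Q lab (lift lab xs path y₀ r₀)
  lift-isPath {suc k} lab xs path y₀ r₀ zero = proj₁ (proj₂ (match r₀ (path zero)))
  lift-isPath {suc k} lab xs path y₀ r₀ (suc j) =
    let (y₁ , _ , r₁) = match r₀ (path zero)
    in lift-isPath (lab ∘ suc) (xs ∘ suc) (path ∘ suc) y₁ r₁ j


Simulates : ∀ {a₁ a₂ u y ℓ₁ ℓ₂ r} {U : Set u} {Y : Set y}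
  (Σ₁ : NTS {a₁} U Y ℓ₁) (Σ₂ : NTS {a₂} U Y ℓ₂) →
  (X Σ₁ → X Σ₂ → Set r) → Set _
Simulates Σ₁ Σ₂ R = ∀ {x₁ x₂} → R x₁ x₂ → ∀ {w x₁'} → Step Σ₁ x₁ w x₁' →
  Σ (X Σ₂) λ x₂' → Step Σ₂ x₂ w x₂' × R x₁' x₂'

module RunTransfer {a₁ a₂ u y ℓ₁ ℓ₂ r} {U : Set u} {Y : Set y}
    (Σ₁ : NTS {a₁} U Y ℓ₁) (Σ₂ : NTS {a₂} U Y ℓ₂)
    (R : X Σ₁ → X Σ₂ → Set r) (sim : Simulates Σ₁ Σ₂ R) {α : List U} where
  open PathLifting (Step Σ₁) (Step Σ₂) R sim

  transfer : (ρ : Run Σ₁ α) (x₂ : X Σ₂) → X₀ Σ₂ x₂ → R (st ρ zero) x₂ → Run Σ₂ α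
  transfer ρ x₂ x₂-init r₀ = record
    { k = k ρ ; k≤ = k≤ ρ
    ; st = lift _ (st ρ) (steps ρ) x₂ r₀
    ; init = x₂-init
    ; steps = lift-isPath _ (st ρ) (steps ρ) x₂ r₀ }

  transfer-related : (ρ : Run Σ₁ α) (x₂ : X Σ₂) (x₂-init : X₀ Σ₂ x₂)
    (r₀ : R (st ρ zero) x₂) → ∀ j → R (st ρ j) (st (transfer ρ x₂ x₂-init r₀) j)
  transfer-related ρ x₂ _ r₀ = lift-related _ (st ρ) (steps ρ) x₂ r₀

  stuck-reflected : Simulates Σ₂ Σ₁ (flip R) → ∀ {x₁ x₂ w} → R x₁ x₂ →
    ¬ (Σ (X Σ₁) λ x₁' → Step Σ₁ x₁ w x₁') → ¬ (Σ (X Σ₂) λ x₂' → Step Σ₂ x₂ w x₂')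
  stuck-reflected back rel stuck (x₂' , step) =
    let (x₁' , step₁ , _) = back rel step in stuck (x₁' , step₁)

  transfer-maximal : Simulates Σ₂ Σ₁ (flip R) →
    (ρ : Run Σ₁ α) (x₂ : X Σ₂) (x₂-init : X₀ Σ₂ x₂) (r₀ : R (st ρ zero) x₂) →
    Maximal Σ₁ ρ → Maximal Σ₂ (transfer ρ x₂ x₂-init r₀)
  transfer-maximal back ρ x₂ x₂-init r₀ (inj₁ full) = inj₁ full
  transfer-maximal back ρ x₂ x₂-init r₀ (inj₂ (k< , stuck)) =
    inj₂ (k< , stuck-reflected back
                 (transfer-related ρ x₂ x₂-init r₀ (fromℕ (k ρ))) stuck)

theorem3p7 : {a₁ a₂ u y ℓ₁ ℓ₂ r : Level} {U : Set u} {Y : Set y}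
    (Σ₁ : NTS {a₁} U Y ℓ₁) (Σ₂ : NTS {a₂} U Y ℓ₂) →
    Σ (X Σ₁ → X Σ₂ → Set r) (IsInitSOPSim Σ₁ Σ₂) →
    InitialStateOpaque Σ₁ → InitialStateOpaque Σ₂
theorem3p7 Σ₁ Σ₂ (_∼_ , sim) opaque₁ α ρ₂ max₂ secret₂ =
  let (x₁ , x₁-init , x₁-secret , rel₀) = init-secret (st ρ₂ zero) (init ρ₂) secret₂
      ρ₁ = Backward.transfer ρ₂ x₁ x₁-init rel₀
      max₁ = Backward.transfer-maximal forth′ ρ₂ x₁ x₁-init rel₀ max₂
      (ρ₁' , max₁' , public₁' , same-length , outputs₁) = opaque₁ α ρ₁ max₁ x₁-secret
      (x₂' , x₂'-init , x₂'-public , rel₀') = init-nonsecret (st ρ₁' zero) (init ρ₁') public₁'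
      ρ₂' = Forward.transfer ρ₁' x₂' x₂'-init rel₀'
  -- outputs agree along ρ₂ ∼ ρ₁, ρ₁ ≈ ρ₁' and ρ₁' ∼ ρ₂' (2)
      outputs = λ j → trans (sym (output _ _ (Backward.transfer-related ρ₂ x₁ x₁-init rel₀ j)))
                  (trans (outputs₁ j)
                         (output _ _ (Forward.transfer-related ρ₁' x₂' x₂'-init rel₀' _)))
  in ρ₂' , Forward.transfer-maximal back′ ρ₁' x₂' x₂'-init rel₀' max₁'
     , x₂'-public , same-length , outputs
  where
  open IsInitSOPSim sim
  forth′ : Simulates Σ₁ Σ₂ _∼_
  forth′ rel step = forth _ _ rel _ _ step
  back′ : Simulates Σ₂ Σ₁ (flip _∼_)
  back′ rel step = back _ _ rel _ _ step
  module Forward = RunTransfer Σ₁ Σ₂ _∼_ forth′ {α}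
  module Backward = RunTransfer Σ₂ Σ₁ (flip _∼_) back′ {α}
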